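{- Let $\mathcal{T}$ be a tangle. (a) If $\overrightarrow{deg}(\mathcal{T})=\langle\,\rangle$, then $\mathcal{T}$ is the circle. (b) If $\overrightarrow{deg}(\mathcal{T})=\langle 2\rangle$, then $\mathcal{T}$ is the closed unit interval. (c) If $\overrightarrow{deg}(\mathcal{T})=\langle 1,0,1\rangle$, then $\mathcal{T}$ is the lollipop. (d) If $\overrightarrow{deg}(\mathcal{T})=\langle 0,0,2\rangle$, then $\mathcal{T}$ is either the handcuffs or the theta. (e) If $\overrightarrow{deg}(\mathcal{T})=\langle 0,0,0,1\rangle$, then $\mathcal{T}$ is the figure 8.
   Context: A tangle is a connected topological space obtained by taking finitely many disjoint copies of $[0,1]$ and identifying some of their endpoints (quotient topology); homeomorphic tangles are regarded as identical. The degree of a point $x$ is the number $k$ such that a small neighborhood of $x$ is homeomorphic to $k$ copies of $[0,1)$ glued at $0$. Points of degree $1$ or at least $3$ are singular. For $i\ge1$ let $d_i$ be the number of singular points of degree $i$ (so $d_2=0$). The degree sequence $\overrightarrow{deg}(\mathcal{T})$ is the vector $\langle d_1,d_2,\dots,d_r\rangle$ where $d_r>0$ and $d_s=0$ for all $s>r$ (the empty vector if there are no singular points). The lollipop is a circle with a segment attached at one endpoint to a point of the circle; the handcuffs are two disjoint circles joined by a segment with one endpoint on each circle; the theta is two points joined by three internally disjoint arcs; the figure 8 is two circles sharing exactly one point. -}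

module Defs where

open import Data.Nat using (ℕ; zero; suc; _+_; _*_; _≤_; _≡ᵇ_)
open import Data.Bool using (Bool; true; false; if_then_else_; _∧_)
open import Data.Fin using (Fin; zero; suc; _≟_)
open import Data.Nat.ListAction using (sum)
open import Data.List using (List; []; _∷_; map; length; filter; upTo; allFin)
open import Data.Product using (Σ; ∃; _×_; _,_)
open import Data.Sum using (_⊎_)
open import Relation.Nullary.Decidable using (⌊_⌋)
open import Relation.Binary.PropositionalEquality using (_≡_)
open import Function.Bundles using (_↔_; Inverse)

-- Combinatorial presentation of a tangle:
-- 'arcs' disjoint copies of [0,1] (indexed by Fin arcs), each with two
-- endpoints (indexed by Fin 2: zero ~ 0, suc zero ~ 1); 'end e s' is the
-- class (point of the quotient) to which endpoint s of arc e is glued.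
record Raw : Set where
  field
    arcs  : ℕ
    verts : ℕ
    end   : Fin arcs → Fin 2 → Fin verts
open Raw public

flip2 : Fin 2 → Fin 2
flip2 zero = suc zero
flip2 (suc zero) = zero

data Conn (T : Raw) (u : Fin (verts T)) : Fin (verts T) → Set where
  here : Conn T u u
  along : ∀ e s → Conn T u (end T e s) → Conn T u (end T e (flip2 s))

-- a tangle: at least one arc, every class consists of endpoints
-- (surjectivity), and the space is connected
record IsTangle (T : Raw) : Set where
  field
    nonempty  : 1 ≤ arcs T
    surj      : ∀ v → ∃ λ e → ∃ λ s → end T e s ≡ v
    connected : ∀ u v → Conn T u v

-- Degrees.  Interior points of arcs have degree 2; a glued point v has
-- degree equal to the number of arc endpoints glued to it.

δ : ∀ {m} → Fin m → Fin m → ℕ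
δ u v = if ⌊ u ≟ v ⌋ then 1 else 0

degree : (T : Raw) → Fin (verts T) → ℕ
degree T v = sum (map (λ e → δ (end T e zero) v + δ (end T e (suc zero)) v) (allFin (arcs T)))

-- d i = number of singular points of degree i (degree-2 points are not
-- singular, so d 2 = 0)
dcount : Raw → ℕ → ℕ
dcount T i = if i ≡ᵇ 2 then 0
             else length (filter (λ v → degree T v Data.Nat.≟ i) (allFin (verts T)))

trim : List ℕ → List ℕ
trim [] = []
trim (x ∷ xs) with trim xs
... | [] = if x ≡ᵇ 0 then [] else x ∷ []
... | y ∷ ys = x ∷ y ∷ ys

-- degree sequence ⟨d_1,…,d_r⟩ with d_r > 0; every degree is ≤ 2·arcs,
-- so listing d_1 … d_{2·arcs} and trimming trailing zeros gives it.
degSeq : Raw → List ℕ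
degSeq T = trim (map (λ i → dcount T (suc i)) (upTo (2 * arcs T)))

record Iso (T T' : Raw) : Set where
  field
    σ : Fin (arcs T) ↔ Fin (arcs T')
    τ : Fin (verts T) ↔ Fin (verts T')
    compat : ∀ e → (∀ s → end T' (Inverse.to σ e) s ≡ Inverse.to τ (end T e s))
                 ⊎ (∀ s → end T' (Inverse.to σ e) s ≡ Inverse.to τ (end T e (flip2 s)))

-- elementary subdivision of arc e: arc e is cut at an interior point,
-- which becomes the new glued point 'zero'; the new arc 'zero' runs from
-- the new point to the old endpoint 1 of e.
subdivide : (T : Raw) → Fin (arcs T) → Raw
subdivide T e = record { arcs = suc (arcs T) ; verts = suc (verts T) ; end = E }
  where
  E : Fin (suc (arcs T)) → Fin 2 → Fin (suc (verts T))
  E zero zero = zero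
  E zero (suc _) = suc (end T e (suc zero))
  E (suc e') s = if ⌊ e' ≟ e ⌋ ∧ ⌊ s ≟ suc zero ⌋ then zero else suc (end T e' s)

data _≃_ : Raw → Raw → Set where
  iso   : ∀ {T T'} → Iso T T' → T ≃ T'
  subd  : ∀ T e → T ≃ subdivide T e
  symm  : ∀ {T T'} → T ≃ T' → T' ≃ T
  trans : ∀ {T T' T''} → T ≃ T' → T' ≃ T'' → T ≃ T''

mk : (a v : ℕ) → (Fin a → Fin 2 → Fin v) → Raw
mk a v f = record { arcs = a ; verts = v ; end = f }

circle : Raw
circle = mk 1 1 (λ _ _ → zero)

interval : Raw
interval = mk 1 2 (λ _ s → s)

lollipop : Raw
lollipop = mk 2 2 f
  where
  f : Fin 2 → Fin 2 → Fin 2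
  f zero _ = zero
  f (suc zero) s = s

handcuffs : Raw
handcuffs = mk 3 2 f
  where
  f : Fin 3 → Fin 2 → Fin 2
  f zero _ = zero
  f (suc zero) _ = suc zero
  f (suc (suc zero)) s = s

theta : Raw
theta = mk 3 2 (λ _ s → s)

figure8 : Raw
figure8 = mk 2 1 (λ _ _ → zero)

-- A point of degree 2 can be smoothed away. If its two arc-ends lie on different arcs, merging
-- those arcs gives a tangle with one arc fewer of which the original is a subdivision, hence
-- homeomorphic and with the same singular points; if both ends lie on one arc, connectedness
-- forces the tangle to be the circle. Once no point of degree 2 is left every point is
-- singular, so the degree sequence fixes the number of points (Σ dᵢ) and, by the handshake
-- lemma, the number of arcs (Σ i·dᵢ / 2). For the five sequences this leaves gluings of at
-- most three arcs on at most two points, which are classified by exhaustive search.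

{-# OPTIONS --safe #-}
module Submission where

open import Defs
open import Data.Nat.Properties hiding (_≟_)
open import Data.Nat.Induction using (<-wellFounded)
open import Induction.WellFounded using (Acc; acc)
open import Algebra.Properties.Semiring.Sum +-*-semiring
  using (sum; sum-cong-≗; sum-remove; sum-permute; ∑-distrib-+; ∑-comm; *-distribˡ-sum)
open import Data.Bool using (true; false; if_then_else_)
open import Data.Fin using (Fin; zero; suc; toℕ; punchIn; punchOut; fromℕ<; _≟_)
open import Data.Fin.Permutation as Perm using (Permutation′; _⟨$⟩ʳ_; _⟨$⟩ˡ_)
open import Data.Fin.Properties using (all?; any?; toℕ<n; punchIn-punchOut; punchInᵢ≢i)
open import Data.List using (List; []; _∷_; map; concatMap; length; filter; allFin; tabulate; applyUpTo; upTo; cartesianProduct)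
open import Data.List.Relation.Unary.Any as Any using (Any)
open import Data.Nat using (ℕ; zero; suc; _+_; _*_; _≤_; _<_; z≤n; s≤s; _≡ᵇ_)
import Data.Nat as ℕ
open import Data.Nat.ListAction using () renaming (sum to listSum)
open import Data.Product using (∃; _×_; _,_; proj₁; proj₂)
open import Data.Sum using (_⊎_; inj₁; inj₂)
import Data.Sum as Sum
import Data.Vec.Functional as Vector
open import Function using (_∘_; id)
open import Function.Bundles using (Injection; mk↔ₛ′)
open import Function.Properties.Inverse using (↔⇒↣)
open import Relation.Nullary using (¬_; Dec; yes; no; does; contradiction)
open import Relation.Nullary.Decidable using (dec-true; dec-false; _⊎-dec_; _→-dec_; from-yes)
open import Relation.Binary.PropositionalEquality hiding (trans)
import Relation.Binary.PropositionalEquality as ≡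

sum-const : ∀ n k → sum {n} (λ _ → k) ≡ n * k
sum-const zero    k = refl
sum-const (suc n) k = cong (k +_) (sum-const n k)

sum-zero : ∀ {n} {f : Fin n → ℕ} → (∀ i → f i ≡ 0) → sum f ≡ 0
sum-zero {n} f≗0 = ≡.trans (sum-cong-≗ f≗0) (≡.trans (sum-const n 0) (*-zeroʳ n))

≤-sum : ∀ {n} (f : Fin n → ℕ) i → f i ≤ sum f
≤-sum f zero    = m≤m+n _ _
≤-sum f (suc i) = ≤-trans (≤-sum (f ∘ suc) i) (m≤n+m _ _)

sum-mono-≤ : ∀ {n} {f g : Fin n → ℕ} → (∀ i → f i ≤ g i) → sum f ≤ sum g
sum-mono-≤ {zero}  _   = z≤n
sum-mono-≤ {suc n} f≤g = +-mono-≤ (f≤g zero) (sum-mono-≤ (f≤g ∘ suc))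

sum≡0⇒ : ∀ {n} (f : Fin n → ℕ) → sum f ≡ 0 → ∀ i → f i ≡ 0
sum≡0⇒ f Σf≡0 i = n≤0⇒n≡0 (subst (f i ≤_) Σf≡0 (≤-sum f i))

sum≡1⇒ : ∀ {n} (f : Fin n → ℕ) → sum f ≡ 1 → ∃ λ i → f i ≡ 1 × (∀ j → j ≢ i → f j ≡ 0)
sum≡1⇒ {suc n} f Σf≡1 with f zero in f₀
... | 0 with sum≡1⇒ (f ∘ suc) Σf≡1
...   | i , fi≡1 , rest = suc i , fi≡1 , λ { zero _ → f₀ ; (suc j) j≢i → rest j (j≢i ∘ cong suc) }
sum≡1⇒ {suc n} f Σf≡1 | 1 = zero , f₀ , λ { zero 0≢0 → contradiction refl 0≢0
                                         ; (suc j) _ → sum≡0⇒ (f ∘ suc) (suc-injective Σf≡1) j }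
sum≡1⇒ {suc n} f () | suc (suc _)

δ-refl : ∀ {n} (u : Fin n) → δ u u ≡ 1
δ-refl u with u ≟ u
... | yes _   = refl
... | no u≢u = contradiction refl u≢u

δ-≢ : ∀ {n} {u v : Fin n} → u ≢ v → δ u v ≡ 0
δ-≢ {u = u} {v} u≢v with u ≟ v
... | yes u≡v = contradiction u≡v u≢v
... | no _    = refl

δ-suc : ∀ {n} (u v : Fin n) → δ (suc u) (suc v) ≡ δ u v
δ-suc u v with u ≟ v
... | yes _ = refl
... | no _  = refl

sum-δ : ∀ {n} (u : Fin n) → sum (δ u) ≡ 1
sum-δ {suc n} zero    = cong suc (sum-zero {n} λ _ → refl)
sum-δ {suc n} (suc u) = ≡.trans (sum-cong-≗ (δ-suc u)) (sum-δ u)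

δ-injective : ∀ {m n} {τ : Fin m → Fin n} → (∀ {u v} → τ u ≡ τ v → u ≡ v) →
              ∀ u v → δ (τ u) (τ v) ≡ δ u v
δ-injective {τ = τ} τ-inj u v with u ≟ v
... | yes refl = δ-refl (τ u)
... | no u≢v   = δ-≢ (u≢v ∘ τ-inj)

incidence : (T : Raw) → Fin (verts T) → Fin (arcs T) → ℕ
incidence T v e = δ (end T e zero) v + δ (end T e (suc zero)) v

listSum-map-tabulate : ∀ {A : Set} n (g : Fin n → A) (h : A → ℕ) → listSum (map h (tabulate g)) ≡ sum (h ∘ g)
listSum-map-tabulate zero    g h = refl
listSum-map-tabulate (suc n) g h = cong (h (g zero) +_) (listSum-map-tabulate n (g ∘ suc) h)

degree≡sum : ∀ T v → degree T v ≡ sum (incidence T v)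
degree≡sum T v = listSum-map-tabulate (arcs T) id (incidence T v)

handshake : ∀ T → sum (degree T) ≡ arcs T * 2
handshake T = begin
  sum (degree T)                                        ≡⟨ sum-cong-≗ (degree≡sum T) ⟩
  sum (λ v → sum λ e → incidence T v e)                 ≡⟨ ∑-comm (incidence T) ⟩
  sum (λ e → sum λ v → incidence T v e)                 ≡⟨ sum-cong-≗ both-ends ⟩
  sum {arcs T} (λ _ → 2)                                ≡⟨ sum-const (arcs T) 2 ⟩
  arcs T * 2                                            ∎
  where
  open ≡-Reasoning
  both-ends : ∀ e → sum (λ v → incidence T v e) ≡ 2
  both-ends e = ≡.trans (∑-distrib-+ (δ (end T e zero)) (δ (end T e (suc zero))))
                        (cong₂ _+_ (sum-δ (end T e zero)) (sum-δ (end T e (suc zero))))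

degree-≤ : ∀ T v → degree T v ≤ arcs T * 2
degree-≤ T v = begin
  degree T v             ≡⟨ degree≡sum T v ⟩
  sum (incidence T v)    ≤⟨ sum-mono-≤ (λ e → +-mono-≤ (δ≤1 (end T e zero)) (δ≤1 (end T e (suc zero)))) ⟩
  sum {arcs T} (λ _ → 2) ≡⟨ sum-const (arcs T) 2 ⟩
  arcs T * 2             ∎
  where
  open ≤-Reasoning
  δ≤1 : ∀ u → δ u v ≤ 1
  δ≤1 u with u ≟ v
  ... | yes _ = s≤s z≤n
  ... | no _  = z≤n

Misses : (T : Raw) → Fin (verts T) → Fin (arcs T) → Set
Misses T v e = ∀ s → end T e s ≢ v

MeetsOnce : (T : Raw) → Fin (verts T) → Fin (arcs T) → Fin 2 → Set
MeetsOnce T v e s = end T e s ≡ v × end T e (flip2 s) ≢ v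

data Incidence (T : Raw) (v : Fin (verts T)) (e : Fin (arcs T)) : ℕ → Set where
  misses : Misses T v e → Incidence T v e 0
  once   : ∀ s → MeetsOnce T v e s → Incidence T v e 1
  twice  : (∀ s → end T e s ≡ v) → Incidence T v e 2

incidence-view : ∀ T v e → Incidence T v e (incidence T v e)
incidence-view T v e with end T e zero ≟ v | end T e (suc zero) ≟ v
... | yes p | yes q = twice λ { zero → p ; (suc zero) → q }
... | yes p | no q  = once zero (p , q)
... | no p  | yes q = once (suc zero) (q , p)
... | no p  | no q  = misses λ { zero → p ; (suc zero) → q }

module _ (T : Raw) (v : Fin (verts T)) (e : Fin (arcs T)) where

  incidence≡0⇒misses : incidence T v e ≡ 0 → Misses T v e
  incidence≡0⇒misses = view (incidence-view T v e)
    where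
    view : ∀ {k} → Incidence T v e k → k ≡ 0 → Misses T v e
    view (misses m) _ = m

  incidence≡1⇒once : incidence T v e ≡ 1 → ∃ (MeetsOnce T v e)
  incidence≡1⇒once = view (incidence-view T v e)
    where
    view : ∀ {k} → Incidence T v e k → k ≡ 1 → ∃ (MeetsOnce T v e)
    view (once s m) _ = s , m

  meets⇒1≤incidence : ∀ {s} → end T e s ≡ v → 1 ≤ incidence T v e
  meets⇒1≤incidence {s} = view (incidence-view T v e)
    where
    view : ∀ {k} → Incidence T v e k → end T e s ≡ v → 1 ≤ k
    view (misses m) meets = contradiction meets (m s)
    view (once _ _) _     = s≤s z≤n
    view (twice _)  _     = s≤s z≤n

1≤degree : ∀ {T} → IsTangle T → ∀ v → 1 ≤ degree T v
1≤degree {T} tangle v with IsTangle.surj tangle v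
... | e , s , meets = begin
  1                    ≤⟨ meets⇒1≤incidence T v e meets ⟩
  incidence T v e      ≤⟨ ≤-sum (incidence T v) e ⟩
  sum (incidence T v)  ≡⟨ degree≡sum T v ⟨
  degree T v           ∎
  where open ≤-Reasoning

-- Singular counts and the degree sequence

indicator : ∀ {P : Set} → Dec P → ℕ
indicator P? = if does P? then 1 else 0

indicator-yes : ∀ {P : Set} (P? : Dec P) → P → indicator P? ≡ 1
indicator-yes P? p = cong (if_then 1 else 0) (dec-true P? p)

indicator-no : ∀ {P : Set} (P? : Dec P) → ¬ P → indicator P? ≡ 0
indicator-no P? ¬p = cong (if_then 1 else 0) (dec-false P? ¬p)

count : Raw → ℕ → ℕ
count T i = sum λ v → indicator (degree T v ℕ.≟ i)

count≡0 : ∀ T i → (∀ v → degree T v ≢ i) → count T i ≡ 0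
count≡0 T i ≢i = sum-zero λ v → indicator-no (degree T v ℕ.≟ i) (≢i v)

1≤count-degree : ∀ T v → 1 ≤ count T (degree T v)
1≤count-degree T v = subst (_≤ count T (degree T v)) (indicator-yes (degree T v ℕ.≟ degree T v) refl)
                           (≤-sum (λ u → indicator (degree T u ℕ.≟ degree T v)) v)

length-filter≡listSum : ∀ {A : Set} {P : A → Set} (P? : ∀ x → Dec (P x)) xs →
                        length (filter P? xs) ≡ listSum (map (indicator ∘ P?) xs)
length-filter≡listSum P? []       = refl
length-filter≡listSum P? (x ∷ xs) with does (P? x)
... | true  = cong suc (length-filter≡listSum P? xs)
... | false = length-filter≡listSum P? xs

dcount≡count : ∀ T i → i ≢ 2 → dcount T i ≡ count T i
dcount≡count T i i≢2 with i ≡ᵇ 2 | ≡ᵇ⇒≡ i 2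
... | true  | i≡2 = contradiction (i≡2 _) i≢2
... | false | _   = ≡.trans (length-filter≡listSum P? (allFin (verts T)))
                            (listSum-map-tabulate (verts T) id (indicator ∘ P?))
  where P? = λ v → degree T v ℕ.≟ i

large-dcount≡0 : ∀ T i → arcs T * 2 < i → dcount T i ≡ 0
large-dcount≡0 T i large with i ℕ.≟ 2
... | yes refl = refl
... | no i≢2   = ≡.trans (dcount≡count T i i≢2)
                         (count≡0 T i λ v deg≡i → <-irrefl deg≡i (≤-<-trans (degree-≤ T v) large))

-- d ℓ i is the entry dᵢ of ℓ = ⟨d₁, …, d_r⟩; it is 0 for i = 0 and for i > r.
d : List ℕ → ℕ → ℕ
d ℓ       zero          = 0
d []      (suc i)       = 0
d (x ∷ ℓ) (suc zero)    = x
d (x ∷ ℓ) (suc (suc i)) = d ℓ (suc i)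

d-trim : ∀ xs i → d (trim xs) i ≡ d xs i
d-trim []       i = refl
d-trim (x ∷ xs) i with trim xs | d-trim xs
d-trim (x ∷ xs)     zero          | _      | _  = refl
d-trim (x ∷ xs)     (suc (suc i)) | []     | ih with x ≡ᵇ 0
... | true  = ih (suc i)
... | false = ih (suc i)
d-trim (zero ∷ xs)  (suc zero)    | []     | _  = refl
d-trim (suc x ∷ xs) (suc zero)    | []     | _  = refl
d-trim (x ∷ xs)     (suc zero)    | _ ∷ _  | _  = refl
d-trim (x ∷ xs)     (suc (suc i)) | _ ∷ _  | ih = ih (suc i)

d-map-applyUpTo-< : ∀ {n} (h g : ℕ → ℕ) {j} → j < n → d (map g (applyUpTo h n)) (suc j) ≡ g (h j)
d-map-applyUpTo-< h g {zero}  (s≤s _)       = refl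
d-map-applyUpTo-< h g {suc j} (s≤s (s≤s j<n)) = d-map-applyUpTo-< (h ∘ suc) g (s≤s j<n)

d-map-applyUpTo-≥ : ∀ {n} (h g : ℕ → ℕ) {j} → n ≤ j → d (map g (applyUpTo h n)) (suc j) ≡ 0
d-map-applyUpTo-≥ {zero}  h g _                = refl
d-map-applyUpTo-≥ {suc n} h g {suc j} (s≤s n≤j) = d-map-applyUpTo-≥ (h ∘ suc) g n≤j

d-degSeq≡dcount : ∀ {T} → IsTangle T → ∀ i → d (degSeq T) i ≡ dcount T i
d-degSeq≡dcount {T} tangle zero = sym (≡.trans (dcount≡count T 0 (λ ())) (count≡0 T 0 no-isolated))
  where
  no-isolated : ∀ v → degree T v ≢ 0
  no-isolated v deg≡0 = contradiction (subst (1 ≤_) deg≡0 (1≤degree tangle v)) λ ()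
d-degSeq≡dcount {T} tangle (suc j) = ≡.trans (d-trim counts (suc j)) (in-range (j ℕ.<? 2 * arcs T))
  where
  counts = map (dcount T ∘ suc) (upTo (2 * arcs T))
  in-range : Dec (j < 2 * arcs T) → d counts (suc j) ≡ dcount T (suc j)
  in-range (yes j<2a) = d-map-applyUpTo-< id (dcount T ∘ suc) j<2a
  in-range (no j≮2a)  = ≡.trans (d-map-applyUpTo-≥ id (dcount T ∘ suc) (≮⇒≥ j≮2a))
                                (sym (large-dcount≡0 T (suc j) (s≤s (subst (_≤ j) (*-comm 2 (arcs T)) (≮⇒≥ j≮2a)))))

select : ∀ {N} (w : ℕ → ℕ) {k} → k < N → sum {N} (λ i → w (toℕ i) * indicator (k ℕ.≟ toℕ i)) ≡ w k
select {suc N} w {zero}  _         = ≡.trans (cong₂ _+_ (*-identityʳ (w 0)) (sum-zero {N} rest≡0)) (+-identityʳ (w 0))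
  where rest≡0 = λ i → *-zeroʳ (w (suc (toℕ i)))
select {suc N} w {suc k} (s≤s k<N) = ≡.trans (cong (_+ rest) (*-zeroʳ (w 0))) (select (w ∘ suc) k<N)
  where rest = sum {N} λ i → w (suc (toℕ i)) * indicator (k ℕ.≟ toℕ i)

census : ∀ T N (w : ℕ → ℕ) → (∀ v → degree T v < N) →
         sum (w ∘ degree T) ≡ sum {N} (λ i → w (toℕ i) * count T (toℕ i))
census T N w bounded = begin
  sum (w ∘ degree T)
    ≡⟨ sum-cong-≗ {verts T} (λ v → sym (select w (bounded v))) ⟩
  sum (λ v → sum {N} λ i → w (toℕ i) * indicator (degree T v ℕ.≟ toℕ i))
    ≡⟨ ∑-comm {verts T} {N} (λ v i → w (toℕ i) * indicator (degree T v ℕ.≟ toℕ i)) ⟩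
  sum {N} (λ i → sum λ v → w (toℕ i) * indicator (degree T v ℕ.≟ toℕ i))
    ≡⟨ sum-cong-≗ {N} (λ i → sym (*-distribˡ-sum (w (toℕ i)) λ v → indicator (degree T v ℕ.≟ toℕ i))) ⟩
  sum {N} (λ i → w (toℕ i) * count T (toℕ i))
    ∎
  where open ≡-Reasoning

weighted : List ℕ → (ℕ → ℕ) → ℕ
weighted ℓ w = sum {suc (length ℓ)} λ i → w (toℕ i) * d ℓ (toℕ i)

d-support : ∀ ℓ i → 1 ≤ d ℓ i → i ≤ length ℓ
d-support (x ∷ ℓ) (suc zero)    _   = s≤s z≤n
d-support (x ∷ ℓ) (suc (suc i)) pos = s≤s (d-support ℓ (suc i) pos)

sizes : ∀ T ℓ {a b} → (∀ i → count T i ≡ d ℓ i) →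
        weighted ℓ id ≡ a * 2 → weighted ℓ (λ _ → 1) ≡ b * 1 → arcs T ≡ a × verts T ≡ b
sizes T ℓ {a} {b} count≗d arcs-weight verts-weight =
    *-cancelʳ-≡ (arcs T) a 2 (≡.trans (sym (handshake T)) (≡.trans (census-d id) arcs-weight))
  , *-cancelʳ-≡ (verts T) b 1 (≡.trans (sym (sum-const (verts T) 1)) (≡.trans (census-d (λ _ → 1)) verts-weight))
  where
  bounded : ∀ v → degree T v < suc (length ℓ)
  bounded v = s≤s (d-support ℓ (degree T v) (subst (1 ≤_) (count≗d (degree T v)) (1≤count-degree T v)))
  census-d : ∀ w → sum (w ∘ degree T) ≡ weighted ℓ w
  census-d w = ≡.trans (census T _ w bounded)
                       (sum-cong-≗ {suc (length ℓ)} λ i → cong (w (toℕ i) *_) (count≗d (toℕ i)))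

-- Invariance under isomorphism and subdivision

flip2-involutive : ∀ s → flip2 (flip2 s) ≡ s
flip2-involutive zero       = refl
flip2-involutive (suc zero) = refl

iso-refl : ∀ {T} → Iso T T
iso-refl = record { σ = Perm.id ; τ = Perm.id ; compat = λ _ → inj₁ λ _ → refl }

module _ {T T′ : Raw} (I : Iso T T′) where
  open Iso I

  iso-sym : Iso T′ T
  iso-sym = record { σ = Perm.flip σ ; τ = Perm.flip τ ; compat = compat⁻¹ }
    where
    unτ : ∀ {u e′ s} → τ ⟨$⟩ʳ u ≡ end T′ (σ ⟨$⟩ʳ (σ ⟨$⟩ˡ e′)) s → u ≡ τ ⟨$⟩ˡ end T′ e′ s
    unτ {u} {e′} {s} eq = ≡.trans (sym (Perm.inverseˡ τ))
                                  (cong (τ ⟨$⟩ˡ_) (≡.trans eq (cong (λ x → end T′ x s) (Perm.inverseʳ σ))))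
    compat⁻¹ : ∀ e′ → (∀ s → end T (σ ⟨$⟩ˡ e′) s ≡ τ ⟨$⟩ˡ end T′ e′ s)
                    ⊎ (∀ s → end T (σ ⟨$⟩ˡ e′) s ≡ τ ⟨$⟩ˡ end T′ e′ (flip2 s))
    compat⁻¹ e′ with compat (σ ⟨$⟩ˡ e′)
    ... | inj₁ h = inj₁ λ s → unτ (sym (h s))
    ... | inj₂ h = inj₂ λ s →
      unτ (sym (≡.trans (h (flip2 s)) (cong (λ t → τ ⟨$⟩ʳ end T (σ ⟨$⟩ˡ e′) t) (flip2-involutive s))))

  iso-end : ∀ e s → ∃ λ s′ → τ ⟨$⟩ʳ end T e s ≡ end T′ (σ ⟨$⟩ʳ e) s′
                          × τ ⟨$⟩ʳ end T e (flip2 s) ≡ end T′ (σ ⟨$⟩ʳ e) (flip2 s′)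
  iso-end e s with compat e
  ... | inj₁ h = s , sym (h s) , sym (h (flip2 s))
  ... | inj₂ h = flip2 s
               , sym (≡.trans (h (flip2 s)) (cong (λ t → τ ⟨$⟩ʳ end T e t) (flip2-involutive s)))
               , ≡.trans (sym (h s)) (cong (end T′ (σ ⟨$⟩ʳ e)) (sym (flip2-involutive s)))

  conn-iso : ∀ {u w} → Conn T u w → Conn T′ (τ ⟨$⟩ʳ u) (τ ⟨$⟩ʳ w)
  conn-iso here = here
  conn-iso (along e s c) with iso-end e s
  ... | s′ , p , q = subst (Conn T′ _) (sym q) (along (σ ⟨$⟩ʳ e) s′ (subst (Conn T′ _) p (conn-iso c)))

  iso-preserves-tangle : IsTangle T → IsTangle T′
  iso-preserves-tangle tangle = record
    { nonempty  = ≤-trans (s≤s z≤n) (toℕ<n (σ ⟨$⟩ʳ fromℕ< (IsTangle.nonempty tangle)))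
    ; surj      = surj′
    ; connected = λ u′ w′ → subst₂ (Conn T′) (Perm.inverseʳ τ) (Perm.inverseʳ τ)
                                   (conn-iso (IsTangle.connected tangle (τ ⟨$⟩ˡ u′) (τ ⟨$⟩ˡ w′)))
    }
    where
    surj′ : ∀ v′ → ∃ λ e′ → ∃ λ s′ → end T′ e′ s′ ≡ v′
    surj′ v′ with IsTangle.surj tangle (τ ⟨$⟩ˡ v′)
    ... | e , s , meets with iso-end e s
    ...   | s′ , p , _ = σ ⟨$⟩ʳ e , s′ , ≡.trans (sym p) (≡.trans (cong (τ ⟨$⟩ʳ_) meets) (Perm.inverseʳ τ))

  degree-iso : ∀ v → degree T′ (τ ⟨$⟩ʳ v) ≡ degree T v
  degree-iso v = begin
    degree T′ (τ ⟨$⟩ʳ v)                       ≡⟨ degree≡sum T′ _ ⟩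
    sum (incidence T′ (τ ⟨$⟩ʳ v))              ≡⟨ sum-permute (incidence T′ (τ ⟨$⟩ʳ v)) σ ⟩
    sum (incidence T′ (τ ⟨$⟩ʳ v) ∘ (σ ⟨$⟩ʳ_))  ≡⟨ sum-cong-≗ {arcs T} incidence-iso ⟩
    sum (incidence T v)                        ≡⟨ degree≡sum T v ⟨
    degree T v                                 ∎
    where
    open ≡-Reasoning
    δ-τ : ∀ u → δ (τ ⟨$⟩ʳ u) (τ ⟨$⟩ʳ v) ≡ δ u v
    δ-τ u = δ-injective (Injection.injective (↔⇒↣ τ)) u v
    incidence-iso : ∀ e → incidence T′ (τ ⟨$⟩ʳ v) (σ ⟨$⟩ʳ e) ≡ incidence T v e
    incidence-iso e with compat e
    ... | inj₁ h rewrite h zero | h (suc zero) = cong₂ _+_ (δ-τ _) (δ-τ _)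
    ... | inj₂ h rewrite h zero | h (suc zero) =
      ≡.trans (cong₂ _+_ (δ-τ _) (δ-τ _)) (+-comm (δ (end T e (suc zero)) v) _)

  count-iso : ∀ i → count T′ i ≡ count T i
  count-iso i = ≡.trans (sum-permute _ τ)
                        (sum-cong-≗ {verts T} λ v → cong (λ k → indicator (k ℕ.≟ i)) (degree-iso v))

subdivide-kept : ∀ T e x s → ¬ (x ≡ e × s ≡ suc zero) → end (subdivide T e) (suc x) s ≡ suc (end T x s)
subdivide-kept T e x s not-cut with x ≟ e | s ≟ suc zero
... | yes x≡e | yes s≡1 = contradiction (x≡e , s≡1) not-cut
... | yes _   | no _    = refl
... | no _    | _       = refl

subdivide-cut : ∀ T e → end (subdivide T e) (suc e) (suc zero) ≡ zero
subdivide-cut T e with e ≟ e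
... | yes _   = refl
... | no e≢e = contradiction refl e≢e

module _ (T : Raw) (e : Fin (arcs T)) where
  private
    Tₑ = subdivide T e

  contract : Fin (verts Tₑ) → Fin (verts T)
  contract zero    = end T e (suc zero)
  contract (suc u) = u

  contract-new : ∀ s → contract (end Tₑ zero s) ≡ end T e (suc zero)
  contract-new zero       = refl
  contract-new (suc zero) = refl

  contract-old : ∀ x s → contract (end Tₑ (suc x) s) ≡ end T x s
  contract-old x s with x ≟ e
  contract-old x s          | no _     = refl
  contract-old x zero       | yes refl = refl
  contract-old x (suc zero) | yes refl = refl

  conn-contract : ∀ {u w} → Conn Tₑ u w → Conn T (contract u) (contract w)
  conn-contract here = here
  conn-contract (along zero s c) =
    subst (Conn T _) (≡.trans (contract-new s) (sym (contract-new (flip2 s)))) (conn-contract c)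
  conn-contract (along (suc x) s c) =
    subst (Conn T _) (sym (contract-old x (flip2 s)))
          (along x s (subst (Conn T _) (contract-old x s) (conn-contract c)))

  subdivide-reflects-tangle : IsTangle Tₑ → IsTangle T
  subdivide-reflects-tangle tangle = record
    { nonempty  = ≤-trans (s≤s z≤n) (toℕ<n e)
    ; surj      = surj′
    ; connected = λ u w → conn-contract (IsTangle.connected tangle (suc u) (suc w))
    }
    where
    surj′ : ∀ v → ∃ λ x → ∃ λ s → end T x s ≡ v
    surj′ v with IsTangle.surj tangle (suc v)
    ... | zero  , s , meets = e , suc zero , ≡.trans (sym (contract-new s)) (cong contract meets)
    ... | suc x , s , meets = x , s , ≡.trans (sym (contract-old x s)) (cong contract meets)

module _ (T : Raw) (e : Fin (arcs T)) (u : Fin (verts T)) where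
  private
    Tₑ = subdivide T e

  incidence-new-arc : incidence Tₑ (suc u) zero ≡ δ (end T e (suc zero)) u
  incidence-new-arc = δ-suc (end T e (suc zero)) u

  incidence-cut-arc : incidence Tₑ (suc u) (suc e) ≡ δ (end T e zero) u
  incidence-cut-arc = ≡.trans (cong₂ _+_ kept cut) (+-identityʳ _)
    where
    kept = ≡.trans (cong (λ w → δ w (suc u)) (subdivide-kept T e e zero λ ())) (δ-suc _ u)
    cut  = cong (λ w → δ w (suc u)) (subdivide-cut T e)

  incidence-kept-arc : ∀ x → x ≢ e → incidence Tₑ (suc u) (suc x) ≡ incidence T u x
  incidence-kept-arc x x≢e = cong₂ _+_ (kept zero) (kept (suc zero))
    where
    kept : ∀ s → δ (end Tₑ (suc x) s) (suc u) ≡ δ (end T x s) u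
    kept s = ≡.trans (cong (λ w → δ w (suc u)) (subdivide-kept T e x s (x≢e ∘ proj₁))) (δ-suc _ u)

degree-subdivide-old : ∀ T e u → degree (subdivide T e) (suc u) ≡ degree T u
degree-subdivide-old T@record { arcs = suc a } e u = begin
  degree Tₑ (suc u)                      ≡⟨ degree≡sum Tₑ (suc u) ⟩
  incidence Tₑ (suc u) zero + sum inc    ≡⟨ cong₂ _+_ (incidence-new-arc T e u) (sum-remove {i = e} inc) ⟩
  δ₁ + (inc e + sum (inc ∘ punchIn e))   ≡⟨ cong₂ (λ x y → δ₁ + (x + y)) (incidence-cut-arc T e u) (sum-cong-≗ {a} kept) ⟩
  δ₁ + (δ₀ + R)                          ≡⟨ +-assoc δ₁ δ₀ R ⟨
  (δ₁ + δ₀) + R                          ≡⟨ cong (_+ R) (+-comm δ₁ δ₀) ⟩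
  incidence T u e + R                    ≡⟨ sum-remove {i = e} (incidence T u) ⟨
  sum (incidence T u)                    ≡⟨ degree≡sum T u ⟨
  degree T u                             ∎
  where
  open ≡-Reasoning
  Tₑ = subdivide T e
  inc = λ x → incidence Tₑ (suc u) (suc x)
  δ₀ = δ (end T e zero) u
  δ₁ = δ (end T e (suc zero)) u
  R = sum (incidence T u ∘ punchIn e)
  kept : ∀ y → inc (punchIn e y) ≡ incidence T u (punchIn e y)
  kept y = incidence-kept-arc T e u (punchIn e y) (punchInᵢ≢i e y)

degree-subdivide-new : ∀ T e → degree (subdivide T e) zero ≡ 2
degree-subdivide-new T@record { arcs = suc a } e = begin
  degree Tₑ zero                       ≡⟨ degree≡sum Tₑ zero ⟩
  1 + sum inc                          ≡⟨ cong suc (sum-remove {i = e} inc) ⟩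
  1 + (inc e + sum (inc ∘ punchIn e))  ≡⟨ cong₂ (λ x y → 1 + (x + y)) cut (sum-zero {a} off) ⟩
  2                                    ∎
  where
  open ≡-Reasoning
  Tₑ = subdivide T e
  inc = λ x → incidence Tₑ zero (suc x)
  kept : ∀ x s → ¬ (x ≡ e × s ≡ suc zero) → δ (end Tₑ (suc x) s) zero ≡ 0
  kept x s not-cut = cong (λ w → δ w zero) (subdivide-kept T e x s not-cut)
  cut : inc e ≡ 1
  cut = cong₂ _+_ (kept e zero λ ()) (cong (λ w → δ w zero) (subdivide-cut T e))
  off : ∀ y → inc (punchIn e y) ≡ 0
  off y = cong₂ _+_ (kept _ zero (punchInᵢ≢i e y ∘ proj₁)) (kept _ (suc zero) (punchInᵢ≢i e y ∘ proj₁))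

count-subdivide : ∀ T e i → i ≢ 2 → count (subdivide T e) i ≡ count T i
count-subdivide T e i i≢2 = cong₂ _+_ new-vertex (sum-cong-≗ {verts T} old-vertex)
  where
  new-vertex : indicator (degree (subdivide T e) zero ℕ.≟ i) ≡ 0
  new-vertex = indicator-no (degree (subdivide T e) zero ℕ.≟ i)
                            λ deg≡i → i≢2 (≡.trans (sym deg≡i) (degree-subdivide-new T e))
  old-vertex : ∀ u → indicator (degree (subdivide T e) (suc u) ℕ.≟ i) ≡ indicator (degree T u ℕ.≟ i)
  old-vertex u = cong (λ k → indicator (k ℕ.≟ i)) (degree-subdivide-old T e u)

-- Smoothing points of degree two

record _↝_ (T T′ : Raw) : Set where
  field
    homeomorphic  : T ≃ T′
    is-tangle     : IsTangle T′
    same-singular : ∀ i → i ≢ 2 → count T′ i ≡ count T i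
open _↝_

↝-refl : ∀ {T} → IsTangle T → T ↝ T
↝-refl tangle = record { homeomorphic = iso iso-refl ; is-tangle = tangle ; same-singular = λ _ _ → refl }

↝-trans : ∀ {T T′ T″} → T ↝ T′ → T′ ↝ T″ → T ↝ T″
↝-trans r r′ = record
  { homeomorphic  = trans (homeomorphic r) (homeomorphic r′)
  ; is-tangle     = is-tangle r′
  ; same-singular = λ i i≢2 → ≡.trans (same-singular r′ i i≢2) (same-singular r i i≢2)
  }

module _ {a n : ℕ} (f : Fin (suc a) → Fin 2 → Fin n) (v : Fin n) where
  private
    T = mk (suc a) n f

  data Degree2 : Set where
    loop : ∀ e → (∀ s → f e s ≡ v) → (∀ x → x ≢ e → Misses T v x) → Degree2
    path : ∀ r sr e₀ sk → MeetsOnce T v r sr → MeetsOnce T v (punchIn r e₀) sk →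
           (∀ y → y ≢ e₀ → Misses T v (punchIn r y)) → Degree2

  degree2-view : ∀ {e s} → f e s ≡ v → degree T v ≡ 2 → Degree2
  degree2-view {e} {s} meets deg≡2 = by-incidence (incidence-view T v e) split
    where
    rest = sum (incidence T v ∘ punchIn e)
    split : incidence T v e + rest ≡ 2
    split = ≡.trans (sym (sum-remove {i = e} (incidence T v))) (≡.trans (sym (degree≡sum T v)) deg≡2)
    by-incidence : ∀ {k} → Incidence T v e k → k + rest ≡ 2 → Degree2
    by-incidence (misses m) _ = contradiction meets (m s)
    by-incidence (twice l) 2+rest≡2 = loop e l others
      where
      others : ∀ x → x ≢ e → Misses T v x
      others x x≢e = subst (Misses T v) (punchIn-punchOut (x≢e ∘ sym))
        (incidence≡0⇒misses T v (punchIn e x′) (sum≡0⇒ _ (suc-injective (suc-injective 2+rest≡2)) x′))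
        where x′ = punchOut (x≢e ∘ sym)
    by-incidence (once sr r-once) 1+rest≡2 with sum≡1⇒ (incidence T v ∘ punchIn e) (suc-injective 1+rest≡2)
    ... | e₀ , inc≡1 , inc≡0 with incidence≡1⇒once T v (punchIn e e₀) inc≡1
    ...   | sk , k-once = path e sr e₀ sk r-once k-once
                                λ y y≢e₀ → incidence≡0⇒misses T v (punchIn e y) (inc≡0 y y≢e₀)

loop-is-circle : ∀ {T} → IsTangle T → ∀ e v → (∀ s → end T e s ≡ v) → (∀ x → x ≢ e → Misses T v x) →
                 Iso T circle
loop-is-circle {T} tangle e v on-loop others = record
  { σ      = mk↔ₛ′ (λ _ → zero) (λ _ → e) (λ { zero → refl }) (λ x → sym (only-arc x))
  ; τ      = mk↔ₛ′ (λ _ → zero) (λ _ → v) (λ { zero → refl }) (λ u → sym (only-vertex u))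
  ; compat = λ _ → inj₁ λ _ → refl
  }
  where
  stays : ∀ {u} → Conn T v u → u ≡ v
  stays here = refl
  stays (along x s c) with x ≟ e
  ... | yes refl = on-loop (flip2 s)
  ... | no x≢e   = contradiction (stays c) (others x x≢e s)
  only-vertex : ∀ u → u ≡ v
  only-vertex u = stays (IsTangle.connected tangle v u)
  only-arc : ∀ x → x ≡ e
  only-arc x with x ≟ e
  ... | yes x≡e = x≡e
  ... | no x≢e  = contradiction (only-vertex (end T x zero)) (others x x≢e zero)

oriented : ∀ {n} (g h : Fin 2 → Fin n) s → g s ≡ h zero → g (flip2 s) ≡ h (suc zero) →
           (∀ t → g t ≡ h t) ⊎ (∀ t → g t ≡ h (flip2 t))
oriented g h zero       p q = inj₁ λ { zero → p ; (suc zero) → q }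
oriented g h (suc zero) p q = inj₂ λ { zero → q ; (suc zero) → p }

-- Arcs r and k meet v once each. They are merged into the arc e₀ of `smoothed`, running from the
-- far end of k to the far end of r, and v is deleted; subdividing e₀ recovers T, the new point
-- playing v, the new arc playing r and arc suc e₀ playing k.
module Smoothing {a m : ℕ} (f : Fin (suc a) → Fin 2 → Fin (suc m)) (v : Fin (suc m))
                 (r : Fin (suc a)) (sr : Fin 2) (e₀ : Fin a) (sk : Fin 2)
                 (r-once : MeetsOnce (mk (suc a) (suc m) f) v r sr)
                 (k-once : MeetsOnce (mk (suc a) (suc m) f) v (punchIn r e₀) sk)
                 (others : ∀ y → y ≢ e₀ → Misses (mk (suc a) (suc m) f) v (punchIn r y)) where

  private
    T = mk (suc a) (suc m) f
    k = punchIn r e₀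

  far : Fin 2 → Fin (suc m)
  far zero       = f k (flip2 sk)
  far (suc zero) = f r (flip2 sr)

  merged : Fin a → Fin 2 → Fin (suc m)
  merged y s with y ≟ e₀
  ... | yes _ = far s
  ... | no _  = f (punchIn r y) s

  merged-e₀ : ∀ s → merged e₀ s ≡ far s
  merged-e₀ s with e₀ ≟ e₀
  ... | yes _    = refl
  ... | no e₀≢e₀ = contradiction refl e₀≢e₀

  merged≢v : ∀ y s → merged y s ≢ v
  merged≢v y s with y ≟ e₀
  merged≢v y zero       | yes _ = proj₂ k-once
  merged≢v y (suc zero) | yes _ = proj₂ r-once
  merged≢v y s          | no y≢e₀ = others y y≢e₀ s

  smoothed : Raw
  smoothed = mk a m λ y s → punchOut (merged≢v y s ∘ sym)

  private
    Tₛ = subdivide smoothed e₀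
    σ = Perm.insert zero r Perm.id
    τ = Perm.insert zero v Perm.id

    restore : ∀ y s → τ ⟨$⟩ʳ suc (end smoothed y s) ≡ merged y s
    restore y s = punchIn-punchOut (merged≢v y s ∘ sym)

    compat : ∀ x → (∀ s → end T (σ ⟨$⟩ʳ x) s ≡ τ ⟨$⟩ʳ end Tₛ x s)
                 ⊎ (∀ s → end T (σ ⟨$⟩ʳ x) s ≡ τ ⟨$⟩ʳ end Tₛ x (flip2 s))
    compat zero = oriented (f r) (λ s → τ ⟨$⟩ʳ end Tₛ zero s) sr (proj₁ r-once)
                           (sym (≡.trans (restore e₀ (suc zero)) (merged-e₀ (suc zero))))
    compat (suc x) = compat-old x (x ≟ e₀)
      where
      compat-old : ∀ x → Dec (x ≡ e₀) → (∀ s → end T (punchIn r x) s ≡ τ ⟨$⟩ʳ end Tₛ (suc x) s)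
                                      ⊎ (∀ s → end T (punchIn r x) s ≡ τ ⟨$⟩ʳ end Tₛ (suc x) (flip2 s))
      compat-old x (yes refl) = oriented (f k) h (flip2 sk) far-end near-end
        where
        h = λ s → τ ⟨$⟩ʳ end Tₛ (suc e₀) s
        far-end : f k (flip2 sk) ≡ h zero
        far-end = sym (≡.trans (cong (τ ⟨$⟩ʳ_) (subdivide-kept smoothed e₀ e₀ zero λ ()))
                               (≡.trans (restore e₀ zero) (merged-e₀ zero)))
        near-end : f k (flip2 (flip2 sk)) ≡ h (suc zero)
        near-end = ≡.trans (cong (f k) (flip2-involutive sk))
                           (≡.trans (proj₁ k-once) (sym (cong (τ ⟨$⟩ʳ_) (subdivide-cut smoothed e₀))))
      compat-old x (no x≢e₀) = inj₁ λ s →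
        sym (≡.trans (cong (τ ⟨$⟩ʳ_) (subdivide-kept smoothed e₀ x s (x≢e₀ ∘ proj₁)))
                     (≡.trans (restore x s) (merged-other s)))
        where
        merged-other : ∀ s → merged x s ≡ f (punchIn r x) s
        merged-other s with x ≟ e₀
        ... | yes x≡e₀ = contradiction x≡e₀ x≢e₀
        ... | no _     = refl

  subdivision-iso : Iso Tₛ T
  subdivision-iso = record { σ = σ ; τ = τ ; compat = compat }

  smoothing : IsTangle T → T ↝ smoothed
  smoothing tangle = record
    { homeomorphic  = symm (trans (subd smoothed e₀) (iso subdivision-iso))
    ; is-tangle     = subdivide-reflects-tangle smoothed e₀ (iso-preserves-tangle (iso-sym subdivision-iso) tangle)
    ; same-singular = λ i i≢2 → sym (≡.trans (count-iso subdivision-iso i) (count-subdivide smoothed e₀ i i≢2))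
    }

data Step (T : Raw) : Set where
  circular : Iso T circle → Step T
  smaller  : ∀ {T′} → arcs T′ < arcs T → T ↝ T′ → Step T

step : ∀ T → IsTangle T → ∀ v → degree T v ≡ 2 → Step T
step record { arcs = zero } _ _ ()
step record { arcs = suc a ; verts = suc m ; end = f } tangle v deg≡2 with IsTangle.surj tangle v
... | _ , _ , meets with degree2-view f v meets deg≡2
...   | loop e on-loop others = circular (loop-is-circle tangle e v on-loop others)
...   | path r sr e₀ sk r-once k-once others =
        smaller ≤-refl (Smoothing.smoothing f v r sr e₀ sk r-once k-once others tangle)

record Normalised (T : Raw) : Set where
  field
    {core}    : Raw
    reduction : T ↝ core
    shape     : Iso core circle ⊎ (∀ v → degree core v ≢ 2)

normalise : ∀ T → IsTangle T → Normalised T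
normalise T = go T (<-wellFounded (arcs T))
  where
  go : ∀ T → Acc _<_ (arcs T) → IsTangle T → Normalised T
  go T (acc rec) tangle with any? (λ v → degree T v ℕ.≟ 2)
  ... | no ¬deg2 = record { reduction = ↝-refl tangle ; shape = inj₂ λ v deg≡2 → ¬deg2 (v , deg≡2) }
  ... | yes (v , deg≡2) with step T tangle v deg≡2
  ...   | circular I     = record { reduction = ↝-refl tangle ; shape = inj₁ I }
  ...   | smaller lt red = let n = go _ (rec lt) (is-tangle red) in
                           record { reduction = ↝-trans red (Normalised.reduction n) ; shape = Normalised.shape n }

count-circle : ∀ i → i ≢ 2 → count circle i ≡ 0
count-circle i i≢2 = ≡.trans (+-identityʳ _) (indicator-no (2 ℕ.≟ i) (i≢2 ∘ sym))

count≡d-degSeq : ∀ {T} → IsTangle T → ∀ i → i ≢ 2 → count T i ≡ d (degSeq T) i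
count≡d-degSeq {T} tangle i i≢2 = sym (≡.trans (d-degSeq≡dcount tangle i) (dcount≡count T i i≢2))

data Classification (T : Raw) (ℓ : List ℕ) : Set where
  circular : T ≃ circle → (∀ i → i ≢ 2 → d ℓ i ≡ 0) → Classification T ℓ
  regular  : ∀ {T′} → T ≃ T′ → IsTangle T′ → (∀ i → count T′ i ≡ d ℓ i) → Classification T ℓ

classify : ∀ T → IsTangle T → ∀ {ℓ} → degSeq T ≡ ℓ → Classification T ℓ
classify T tangle refl with normalise T tangle
... | record { core = T′ ; reduction = red ; shape = inj₁ I } =
  circular (trans (homeomorphic red) (iso I)) λ i i≢2 → begin
    d (degSeq T) i   ≡⟨ count≡d-degSeq tangle i i≢2 ⟨
    count T i        ≡⟨ same-singular red i i≢2 ⟨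
    count T′ i       ≡⟨ count-iso I i ⟨
    count circle i   ≡⟨ count-circle i i≢2 ⟩
    0                ∎
  where open ≡-Reasoning
... | record { core = T′ ; reduction = red ; shape = inj₂ ¬deg2 } =
  regular (homeomorphic red) (is-tangle red) count≡d
  where
  count≡d : ∀ i → count T′ i ≡ d (degSeq T) i
  count≡d i with i ℕ.≟ 2
  ... | yes refl = ≡.trans (count≡0 T′ 2 ¬deg2) (sym (d-degSeq≡dcount tangle 2))
  ... | no i≢2   = ≡.trans (same-singular red i i≢2) (count≡d-degSeq tangle i i≢2)

-- Gluings of at most three arcs

Ends : ℕ → ℕ → Set
Ends a b = Fin a → Fin 2 → Fin b

prepend : ∀ {a b} → Fin b → Fin b → Ends a b → Ends (suc a) b
prepend x y g = (x Vector.∷ y Vector.∷ Vector.[]) Vector.∷ g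

Tabulated : ∀ a b → (Ends a b → Set) → Set
Tabulated zero    b P = P Vector.[]
Tabulated (suc a) b P = ∀ x y → Tabulated a b (P ∘ prepend x y)

tabulated? : ∀ a b {P : Ends a b → Set} → (∀ f → Dec (P f)) → Dec (Tabulated a b P)
tabulated? zero    b P? = P? Vector.[]
tabulated? (suc a) b P? = all? λ x → all? λ y → tabulated? a b (P? ∘ prepend x y)

rebuild : ∀ {a b} → Ends a b → Ends a b
rebuild {zero}  f = Vector.[]
rebuild {suc a} f = prepend (f zero zero) (f zero (suc zero)) (rebuild (f ∘ suc))

untabulate : ∀ {a b} (P : Ends a b → Set) → Tabulated a b P → ∀ f → P (rebuild f)
untabulate {zero}  P t f = t
untabulate {suc a} P t f = untabulate _ (t (f zero zero) (f zero (suc zero))) (f ∘ suc)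

rebuild-≗ : ∀ {a b} (f : Ends a b) e s → f e s ≡ rebuild f e s
rebuild-≗ f zero    zero       = refl
rebuild-≗ f zero    (suc zero) = refl
rebuild-≗ f (suc e) s          = rebuild-≗ (f ∘ suc) e s

rebuild-iso : ∀ {a b} (f : Ends a b) → Iso (mk a b f) (mk a b (rebuild f))
rebuild-iso f = record { σ = Perm.id ; τ = Perm.id ; compat = λ e → inj₁ (sym ∘ rebuild-≗ f e) }

permutations : ∀ n → List (Permutation′ n)
permutations zero    = Perm.id ∷ []
permutations (suc n) = concatMap (λ j → map (Perm.insert zero j) (permutations n)) (allFin (suc n))

IsoVia : ∀ {a b} → Ends a b → Ends a b → Permutation′ a × Permutation′ b → Set
IsoVia f g (σ , τ) = ∀ e → (∀ s → g (σ ⟨$⟩ʳ e) s ≡ τ ⟨$⟩ʳ f e s)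
                          ⊎ (∀ s → g (σ ⟨$⟩ʳ e) s ≡ τ ⟨$⟩ʳ f e (flip2 s))

IsoFound : ∀ {a b} → Ends a b → Ends a b → Set
IsoFound {a} {b} f g = Any (IsoVia f g) (cartesianProduct (permutations a) (permutations b))

isoFound? : ∀ {a b} (f g : Ends a b) → Dec (IsoFound f g)
isoFound? {a} {b} f g = Any.any? via? (cartesianProduct (permutations a) (permutations b))
  where
  via? : ∀ στ → Dec (IsoVia f g στ)
  via? (σ , τ) = all? λ e → all? (λ s → g (σ ⟨$⟩ʳ e) s ≟ τ ⟨$⟩ʳ f e s)
                     ⊎-dec all? (λ s → g (σ ⟨$⟩ʳ e) s ≟ τ ⟨$⟩ʳ f e (flip2 s))

found-iso : ∀ {a b} (f g : Ends a b) → IsoFound (rebuild f) g → mk a b f ≃ mk a b g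
found-iso f g found with Any.satisfied found
... | (σ , τ) , via = trans (iso (rebuild-iso f)) (iso (record { σ = σ ; τ = τ ; compat = via }))

count-rebuild : ∀ {a b} (f : Ends a b) i {k} → count (mk a b f) i ≡ k → count (mk a b (rebuild f)) i ≡ k
count-rebuild f i = ≡.trans (count-iso (rebuild-iso f) i)

IntervalCase : Ends 1 2 → Set
IntervalCase f = count (mk 1 2 f) 1 ≡ 2 → IsoFound f (end interval)

LollipopCase : Ends 2 2 → Set
LollipopCase f = count (mk 2 2 f) 1 ≡ 1 → count (mk 2 2 f) 3 ≡ 1 → IsoFound f (end lollipop)

HandcuffsThetaCase : Ends 3 2 → Set
HandcuffsThetaCase f = count (mk 3 2 f) 3 ≡ 2 → IsoFound f (end handcuffs) ⊎ IsoFound f (end theta)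

Figure8Case : Ends 2 1 → Set
Figure8Case f = IsoFound f (end figure8)

-- Proved by evaluation: `from-yes` runs the decision procedure over all b^(2a) tables.
interval-cases : Tabulated 1 2 IntervalCase
interval-cases = from-yes (tabulated? 1 2 λ f → count (mk 1 2 f) 1 ℕ.≟ 2 →-dec isoFound? f (end interval))

lollipop-cases : Tabulated 2 2 LollipopCase
lollipop-cases = from-yes (tabulated? 2 2 λ f →
  count (mk 2 2 f) 1 ℕ.≟ 1 →-dec count (mk 2 2 f) 3 ℕ.≟ 1 →-dec isoFound? f (end lollipop))

handcuffs-theta-cases : Tabulated 3 2 HandcuffsThetaCase
handcuffs-theta-cases = from-yes (tabulated? 3 2 λ f →
  count (mk 3 2 f) 3 ℕ.≟ 2 →-dec (isoFound? f (end handcuffs) ⊎-dec isoFound? f (end theta)))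

figure8-cases : Tabulated 2 1 Figure8Case
figure8-cases = from-yes (tabulated? 2 1 λ f → isoFound? f (end figure8))

interval-shape : ∀ T → arcs T ≡ 1 → verts T ≡ 2 → count T 1 ≡ 2 → T ≃ interval
interval-shape record { end = f } refl refl c₁ =
  found-iso f (end interval) (untabulate IntervalCase interval-cases f (count-rebuild f 1 c₁))

lollipop-shape : ∀ T → arcs T ≡ 2 → verts T ≡ 2 → count T 1 ≡ 1 → count T 3 ≡ 1 → T ≃ lollipop
lollipop-shape record { end = f } refl refl c₁ c₃ =
  found-iso f (end lollipop) (untabulate LollipopCase lollipop-cases f (count-rebuild f 1 c₁) (count-rebuild f 3 c₃))

handcuffs-theta-shape : ∀ T → arcs T ≡ 3 → verts T ≡ 2 → count T 3 ≡ 2 → T ≃ handcuffs ⊎ T ≃ theta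
handcuffs-theta-shape record { end = f } refl refl c₃ =
  Sum.map (found-iso f (end handcuffs)) (found-iso f (end theta))
          (untabulate HandcuffsThetaCase handcuffs-theta-cases f (count-rebuild f 3 c₃))

figure8-shape : ∀ T → arcs T ≡ 2 → verts T ≡ 1 → T ≃ figure8
figure8-shape record { end = f } refl refl = found-iso f (end figure8) (untabulate Figure8Case figure8-cases f)

degSeq-circle : ∀ T → IsTangle T → degSeq T ≡ [] → T ≃ circle
degSeq-circle T tangle ds with classify T tangle ds
... | circular T≃circle _ = T≃circle
... | regular {T′} _ tangle′ c with sizes T′ [] {0} {0} c refl refl
...   | arcs≡0 , _ = contradiction (subst (1 ≤_) arcs≡0 (IsTangle.nonempty tangle′)) λ ()

degSeq-interval : ∀ T → IsTangle T → degSeq T ≡ 2 ∷ [] → T ≃ interval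
degSeq-interval T tangle ds with classify T tangle ds
... | circular _ d≡0 = contradiction (d≡0 1 λ ()) λ ()
... | regular {T′} T≃T′ _ c with sizes T′ (2 ∷ []) {1} {2} c refl refl
...   | arcs≡1 , verts≡2 = trans T≃T′ (interval-shape _ arcs≡1 verts≡2 (c 1))

degSeq-lollipop : ∀ T → IsTangle T → degSeq T ≡ 1 ∷ 0 ∷ 1 ∷ [] → T ≃ lollipop
degSeq-lollipop T tangle ds with classify T tangle ds
... | circular _ d≡0 = contradiction (d≡0 1 λ ()) λ ()
... | regular {T′} T≃T′ _ c with sizes T′ (1 ∷ 0 ∷ 1 ∷ []) {2} {2} c refl refl
...   | arcs≡2 , verts≡2 = trans T≃T′ (lollipop-shape _ arcs≡2 verts≡2 (c 1) (c 3))

degSeq-handcuffs-theta : ∀ T → IsTangle T → degSeq T ≡ 0 ∷ 0 ∷ 2 ∷ [] → T ≃ handcuffs ⊎ T ≃ theta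
degSeq-handcuffs-theta T tangle ds with classify T tangle ds
... | circular _ d≡0 = contradiction (d≡0 3 λ ()) λ ()
... | regular {T′} T≃T′ _ c with sizes T′ (0 ∷ 0 ∷ 2 ∷ []) {3} {2} c refl refl
...   | arcs≡3 , verts≡2 = Sum.map (trans T≃T′) (trans T≃T′) (handcuffs-theta-shape _ arcs≡3 verts≡2 (c 3))

degSeq-figure8 : ∀ T → IsTangle T → degSeq T ≡ 0 ∷ 0 ∷ 0 ∷ 1 ∷ [] → T ≃ figure8
degSeq-figure8 T tangle ds with classify T tangle ds
... | circular _ d≡0 = contradiction (d≡0 4 λ ()) λ ()
... | regular {T′} T≃T′ _ c with sizes T′ (0 ∷ 0 ∷ 0 ∷ 1 ∷ []) {2} {1} c refl refl
...   | arcs≡2 , verts≡1 = trans T≃T′ (figure8-shape _ arcs≡2 verts≡1)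

claim3p2 : (T : Raw) → IsTangle T →
    ((degSeq T ≡ [] → T ≃ circle)
    × (degSeq T ≡ 2 ∷ [] → T ≃ interval)
    × (degSeq T ≡ 1 ∷ 0 ∷ 1 ∷ [] → T ≃ lollipop)
    × (degSeq T ≡ 0 ∷ 0 ∷ 2 ∷ [] → (T ≃ handcuffs) ⊎ (T ≃ theta))
    × (degSeq T ≡ 0 ∷ 0 ∷ 0 ∷ 1 ∷ [] → T ≃ figure8))
claim3p2 T tangle =
  degSeq-circle T tangle , degSeq-interval T tangle , degSeq-lollipop T tangle ,
  degSeq-handcuffs-theta T tangle , degSeq-figure8 T tangle
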